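{- Let $\Sigma$ be a compatible split system on $X$ such that $\mathbb{P}(\Sigma)$ contains a hierarchical partition system, and let $\Pi\in\mathbb{P}(\Sigma)$. Then $\Pi$ is hierarchical if and only if $\Pi$ is $\mathbb{P}(\mathcal{T}_\Sigma)$-minimum, i.e. $|\Pi|\le|\Pi'|$ for all $\Pi'\in\mathbb{P}(\Sigma)$.
   Context: $X$ is a finite set with $|X|\ge 2$. A partition of $X$ is a set of $t\ge 2$ pairwise disjoint non-empty subsets (parts) whose union is $X$; an $X$-split is a partition with two parts, written $A|(X-A)$. Split systems and partition systems on $X$ are finite multisets of splits, resp. partitions, of $X$; sizes count multiplicities. $\Sigma_\pi=\biguplus_{A\in\pi}\{A|(X-A)\}$ and $\Sigma_\Pi=\biguplus_{\pi\in\Pi}\Sigma_\pi$ (multiset union). $\mathbb{P}(\Sigma)$ is the set of partition systems $\Pi$ on $X$ with $\Sigma_\Pi=\Sigma$. A split system is compatible if for any two of its splits $A_1|B_1,A_2|B_2$ one of $A_1\cap A_2,A_1\cap B_2,B_1\cap A_2,B_1\cap B_2$ is empty; a compatible $\Sigma$ is realized by a weak $X$-tree $\mathcal{T}_\Sigma$ (tree with a map $\phi:X\to V$ with all leaves in $\phi(X)$, whose edges $e$ give splits $\phi^{ -1}(W)|(X-\phi^{ -1}(W))$, $W$ a component of the tree minus $e$, with multiset of these splits equal to $\Sigma$), unique up to isomorphism; $\mathbb{P}(\mathcal{T}_\Sigma)=\mathbb{P}(\Sigma)$, and $\Pi$ is $\mathbb{P}(\mathcal{T}_\Sigma)$-minimum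 if it has minimum size in $\mathbb{P}(\Sigma)$. A partition system $\Pi$ is hierarchical if the set $\bigcup_{\pi\in\Pi}\pi$ of all parts of all its partitions is a hierarchy, i.e. $A\cap B\in\{\emptyset,A,B\}$ for all such parts $A,B$. -}

module Defs where

open import Data.Nat using (ℕ; suc; _≤_; _≥_)
open import Data.Fin using (Fin; zero)
open import Data.Bool using (if_then_else_)
open import Data.Fin.Subset using (Subset; _∩_; ∁; ⊥; Nonempty; _∈_)
open import Data.List using (List; length; lookup; concatMap; map)
import Data.List.Membership.Propositional as LM
open import Data.List.Relation.Binary.Permutation.Propositional using (_↭_)
open import Data.Product using (Σ; _×_; ∃-syntax)
open import Data.Sum using (_⊎_)
open import Relation.Binary.PropositionalEquality using (_≡_; _≢_)
import Data.Vec as Vec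

-- Throughout, X = Fin (suc m) (so |X| ≥ 2 iff m ≥ 1).
-- Subsets of X are stdlib 'Subset (suc m)'.

-- An X-split A|(X-A) is recorded by one of its sides; it is a valid split
-- when both sides are non-empty.
IsSplit : ∀ {n} → Subset n → Set
IsSplit A = Nonempty A × Nonempty (∁ A)

-- Canonical representative of the (unordered) split A|(X-A):
-- the side NOT containing the element zero.  Two subsets give the same split
-- iff they have the same canonical representative.
canon : ∀ {m} → Subset (suc m) → Subset (suc m)
canon A = if Vec.lookup A zero then ∁ A else A

-- A split system: a finite multiset of splits, represented as a list of
-- canonical representatives (multiset equality = permutation, _↭_).
SplitSystem : ℕ → Set
SplitSystem m = List (Subset (suc m))

IsSplitSystem : ∀ {m} → SplitSystem m → Set
IsSplitSystem {m} S = ∀ A → A LM.∈ S → IsSplit A × canon A ≡ A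

Compatible : ∀ {m} → SplitSystem m → Set
Compatible S = ∀ A₁ A₂ → A₁ LM.∈ S → A₂ LM.∈ S →
  (A₁ ∩ A₂ ≡ ⊥) ⊎ (A₁ ∩ ∁ A₂ ≡ ⊥) ⊎ (∁ A₁ ∩ A₂ ≡ ⊥) ⊎ (∁ A₁ ∩ ∁ A₂ ≡ ⊥)

-- A partition of X: a list of t ≥ 2 non-empty, pairwise disjoint parts
-- whose union is X (disjoint non-empty parts are automatically distinct,
-- so the list represents a set of parts).
IsPartition : ∀ {n} → List (Subset n) → Set
IsPartition {n} π =
  (2 ≤ length π)
  × (∀ A → A LM.∈ π → Nonempty A)
  × (∀ i j → i ≢ j → lookup π i ∩ lookup π j ≡ ⊥)
  × (∀ (x : Fin n) → ∃[ A ] (A LM.∈ π × x ∈ A))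

PartitionSystem : ℕ → Set
PartitionSystem m = List (List (Subset (suc m)))

IsPartitionSystem : ∀ {m} → PartitionSystem m → Set
IsPartitionSystem Π = ∀ π → π LM.∈ Π → IsPartition π

splitsOf : ∀ {m} → List (Subset (suc m)) → SplitSystem m
splitsOf π = map canon π

splitsOfSystem : ∀ {m} → PartitionSystem m → SplitSystem m
splitsOfSystem Π = concatMap splitsOf Π

InP : ∀ {m} → SplitSystem m → PartitionSystem m → Set
InP S Π = IsPartitionSystem Π × (splitsOfSystem Π ↭ S)

Hierarchical : ∀ {m} → PartitionSystem m → Set
Hierarchical Π = ∀ π π′ A B → π LM.∈ Π → π′ LM.∈ Π → A LM.∈ π → B LM.∈ π′ →
  (A ∩ B ≡ ⊥) ⊎ (A ∩ B ≡ A) ⊎ (A ∩ B ≡ B)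

IsMinimum : ∀ {m} → SplitSystem m → PartitionSystem m → Set
IsMinimum S Π = ∀ Π′ → InP S Π′ → length Π ≤ length Π′

module Submission where

-- The proof rests on a counting identity.  For points a, b let sep(a,b) be the
-- number of splits of Σ separating a from b, and T_Π(a,b) the number of parts
-- (over all partitions of Π) containing both a and b.  Each partition of X
-- contributes either two separating splits (a, b in different parts) or one
-- part containing both, so
--            sep(a,b) + 2·T_Π(a,b) = 2·|Π|     for every Π ∈ ℙ(Σ).
-- (⇒) In a hierarchical Π some point x shares no part with the point 0 (take x
--     outside the largest part containing 0), so 2|Π| = sep(x,0) ≤ 2|Π'|.
-- (⇐) If Π is minimum and H ∈ ℙ(Σ) is hierarchical, then |Π| = |H| by (⇒), so
--     T_Π = T_H: Π joins exactly the pairs that H joins, and "being in a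
--     common part" is transitive in the hierarchical H.  Two parts A, B of Π
--     come from compatible splits, hence are disjoint, nested, or cover X; in
--     the last case a common point z would join x and 0 through z in H.

open import Defs
open import Data.Nat using (ℕ; suc; _+_; _*_; _≥_; s≤s; _≟_)
open import Data.Nat.Properties
  using (+-cancelˡ-≡; *-cancelˡ-≡; *-cancelˡ-≤; *-suc; m≤m+n; +-identityʳ; ≤-antisym; m+n≡0⇒m≡0; m+n≡0⇒n≡0; module ≤-Reasoning)
open import Data.Nat.ListAction using (sum)
open import Data.Nat.ListAction.Properties using (sum-++; sum-↭)
open import Data.Nat.Tactic.RingSolver using (solve-∀)
open import Data.Bool using (Bool; true; false; not; _∧_; _xor_)
open import Data.Bool.Properties using (¬-not)
open import Data.Fin using (Fin; zero)
import Data.Fin as Fin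
open import Data.Fin.Properties using (suc-injective)
open import Data.Fin.Subset using (Subset; _∩_; ∁; ⊥; _∈_; _∉_; _⊆_)
open import Data.Fin.Subset.Properties
  using (_∈?_; ∉⊥; Empty-unique; x∈p∩q⁺; x∈p∩q⁻; p∩q⊆p; p∩q⊆q; ⊆-antisym; x∈∁p⇒x∉p; x∈p⇒x∉∁p; x∉∁p⇒x∈p; x∉p⇒x∈∁p)
open import Data.List using (List; []; _∷_; length; lookup; map; _++_)
open import Data.List.Properties using (map-∘; map-cong; map-++)
open import Data.List.Membership.Propositional using () renaming (_∈_ to _∈ₗ_)
open import Data.List.Membership.Propositional.Properties using (∈-map⁺; ∈-concatMap⁺)
open import Data.List.Relation.Unary.Any using (here; there; index)
import Data.List.Relation.Unary.Any as Any
open import Data.List.Relation.Unary.Any.Properties using (lookup-index)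
open import Data.List.Relation.Binary.Permutation.Propositional using (_↭_)
open import Data.List.Relation.Binary.Permutation.Propositional.Properties using (∈-resp-↭; map⁺)
open import Data.Product using (_×_; _,_; proj₁; proj₂; ∃-syntax)
open import Data.Sum using (_⊎_; inj₁; inj₂; [_,_])
open import Data.Empty using (⊥-elim)
open import Function using (_∘_; id)
open import Function.Bundles using (_⇔_; mk⇔)
open import Relation.Nullary using (¬_; yes; no)
open import Relation.Binary.PropositionalEquality using (_≡_; _≢_; refl; sym; trans; cong; cong₂; subst; module ≡-Reasoning)
open import Data.Vec.Properties using ([]=⇒lookup; lookup⇒[]=; lookup-map)
import Data.Vec as Vec

private
  variable
    n m : ℕ

Disjoint : Subset n → Subset n → Set
Disjoint U V = ∀ {z} → z ∈ U → z ∉ V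

Covers : Subset n → Subset n → Set
Covers U V = ∀ z → z ∈ U ⊎ z ∈ V

Nested : Subset n → Subset n → Set
Nested A B = (A ∩ B ≡ ⊥) ⊎ (A ∩ B ≡ A) ⊎ (A ∩ B ≡ B)

disjoint-sym : {U V : Subset n} → Disjoint U V → Disjoint V U
disjoint-sym d z∈V z∈U = d z∈U z∈V

∩≡⊥⇒disjoint : {U V : Subset n} → U ∩ V ≡ ⊥ → Disjoint U V
∩≡⊥⇒disjoint U∩V≡⊥ z∈U z∈V = ∉⊥ (subst (_ ∈_) U∩V≡⊥ (x∈p∩q⁺ (z∈U , z∈V)))

disjoint⇒∩≡⊥ : {U V : Subset n} → Disjoint U V → U ∩ V ≡ ⊥
disjoint⇒∩≡⊥ {U = U} {V} d = Empty-unique λ (z , z∈U∩V) →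
  let (z∈U , z∈V) = x∈p∩q⁻ U V z∈U∩V in d z∈U z∈V

∩≡ˡ⇒⊆ : {U V : Subset n} → U ∩ V ≡ U → U ⊆ V
∩≡ˡ⇒⊆ {U = U} {V} e z∈U = proj₂ (x∈p∩q⁻ U V (subst (_ ∈_) (sym e) z∈U))

∩≡ʳ⇒⊇ : {U V : Subset n} → U ∩ V ≡ V → V ⊆ U
∩≡ʳ⇒⊇ {U = U} {V} e z∈V = proj₁ (x∈p∩q⁻ U V (subst (_ ∈_) (sym e) z∈V))

⊆⇒∩≡ˡ : {U V : Subset n} → U ⊆ V → U ∩ V ≡ U
⊆⇒∩≡ˡ {U = U} {V} U⊆V = ⊆-antisym (p∩q⊆p U V) (λ z∈U → x∈p∩q⁺ (z∈U , U⊆V z∈U))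

⊇⇒∩≡ʳ : {U V : Subset n} → V ⊆ U → U ∩ V ≡ V
⊇⇒∩≡ʳ {U = U} {V} V⊆U = ⊆-antisym (p∩q⊆q U V) (λ z∈V → x∈p∩q⁺ (V⊆U z∈V , z∈V))

disjoint-∁⇒⊆ : {U V : Subset n} → Disjoint U (∁ V) → U ⊆ V
disjoint-∁⇒⊆ d z∈U = x∉∁p⇒x∈p (d z∈U)

∁-involutive : (U : Subset n) → ∁ (∁ U) ≡ U
∁-involutive U = ⊆-antisym (x∉∁p⇒x∈p ∘ x∈∁p⇒x∉p) (x∉p⇒x∈∁p ∘ x∈p⇒x∉∁p)

overlapping-nested : {A B : Subset n} {z : Fin n} → Nested A B → z ∈ A → z ∈ B → A ⊆ B ⊎ B ⊆ A
overlapping-nested (inj₁ A∩B≡⊥) z∈A z∈B = ⊥-elim (∩≡⊥⇒disjoint A∩B≡⊥ z∈A z∈B)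
overlapping-nested (inj₂ (inj₁ e)) _ _ = inj₁ (∩≡ˡ⇒⊆ e)
overlapping-nested (inj₂ (inj₂ e)) _ _ = inj₂ (∩≡ʳ⇒⊇ e)

-- Compatible pairs of subsets

-- Sides U, V of two compatible splits: one of the four quadrants
-- U∩V, U∩∁V, ∁U∩V, ∁U∩∁V is empty, read in terms of U and V.
data CompatiblePair (U V : Subset n) : Set where
  disjoint     : Disjoint U V → CompatiblePair U V
  nested-left  : U ⊆ V → CompatiblePair U V
  nested-right : V ⊆ U → CompatiblePair U V
  covering     : Covers U V → CompatiblePair U V

quadrant⇒compatiblePair : {U V : Subset n} →
  (U ∩ V ≡ ⊥) ⊎ (U ∩ ∁ V ≡ ⊥) ⊎ (∁ U ∩ V ≡ ⊥) ⊎ (∁ U ∩ ∁ V ≡ ⊥) → CompatiblePair U V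
quadrant⇒compatiblePair (inj₁ e) = disjoint (∩≡⊥⇒disjoint e)
quadrant⇒compatiblePair (inj₂ (inj₁ e)) = nested-left (disjoint-∁⇒⊆ (∩≡⊥⇒disjoint e))
quadrant⇒compatiblePair (inj₂ (inj₂ (inj₁ e))) = nested-right (disjoint-∁⇒⊆ (disjoint-sym (∩≡⊥⇒disjoint e)))
quadrant⇒compatiblePair {U = U} (inj₂ (inj₂ (inj₂ e))) = covering cover
  where
  cover : Covers U _
  cover z with z ∈? U
  ... | yes z∈U = inj₁ z∈U
  ... | no z∉U = inj₂ (x∉∁p⇒x∈p (∩≡⊥⇒disjoint e (x∉p⇒x∈∁p z∉U)))

compatiblePair-sym : {U V : Subset n} → CompatiblePair U V → CompatiblePair V U
compatiblePair-sym (disjoint d) = disjoint (disjoint-sym d)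
compatiblePair-sym (nested-left U⊆V) = nested-right U⊆V
compatiblePair-sym (nested-right V⊆U) = nested-left V⊆U
compatiblePair-sym (covering c) = covering ([ inj₂ , inj₁ ] ∘ c)

-- Compatibility is a property of splits: it survives replacing a side by
-- its complement.
compatiblePair-∁ˡ : {U V : Subset n} → CompatiblePair U V → CompatiblePair (∁ U) V
compatiblePair-∁ˡ (disjoint d) = nested-right (λ z∈V → x∉p⇒x∈∁p (λ z∈U → d z∈U z∈V))
compatiblePair-∁ˡ {U = U} (nested-left U⊆V) = covering cover
  where
  cover : Covers (∁ U) _
  cover z with z ∈? U
  ... | yes z∈U = inj₂ (U⊆V z∈U)
  ... | no z∉U = inj₁ (x∉p⇒x∈∁p z∉U)
compatiblePair-∁ˡ (nested-right V⊆U) = disjoint (λ z∈∁U z∈V → x∈∁p⇒x∉p z∈∁U (V⊆U z∈V))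
compatiblePair-∁ˡ (covering c) =
  nested-left (λ {z} z∈∁U → [ ⊥-elim ∘ x∈∁p⇒x∉p z∈∁U , id ] (c z))

canon-or-∁ : (A : Subset (suc m)) → canon A ≡ A ⊎ canon A ≡ ∁ A
canon-or-∁ A with Vec.lookup A zero
... | true = inj₂ refl
... | false = inj₁ refl

compatiblePair-uncanonˡ : {V : Subset (suc m)} (U : Subset (suc m)) → CompatiblePair (canon U) V → CompatiblePair U V
compatiblePair-uncanonˡ {V = V} U c with canon-or-∁ U
... | inj₁ e = subst (λ W → CompatiblePair W V) e c
... | inj₂ e = subst (λ W → CompatiblePair W V) (∁-involutive U)
                 (compatiblePair-∁ˡ (subst (λ W → CompatiblePair W V) e c))

compatiblePair-canon : {A B : Subset (suc m)} → CompatiblePair (canon A) (canon B) → CompatiblePair A B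
compatiblePair-canon {A = A} {B} c =
  compatiblePair-uncanonˡ A (compatiblePair-sym (compatiblePair-uncanonˡ B (compatiblePair-sym c)))

PairwiseDisjoint : List (Subset n) → Set
PairwiseDisjoint π = ∀ i j → i ≢ j → lookup π i ∩ lookup π j ≡ ⊥

disjoint-head : {C D : Subset n} {L : List (Subset n)} → PairwiseDisjoint (C ∷ L) → D ∈ₗ L → Disjoint C D
disjoint-head {C = C} d D∈L = ∩≡⊥⇒disjoint
  (subst (λ W → C ∩ W ≡ ⊥) (sym (lookup-index D∈L)) (d zero (Fin.suc (index D∈L)) λ ()))

disjoint-tail : {C : Subset n} {L : List (Subset n)} → PairwiseDisjoint (C ∷ L) → PairwiseDisjoint L
disjoint-tail d i j i≢j = d (Fin.suc i) (Fin.suc j) (i≢j ∘ suc-injective)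

part-unique : {π : List (Subset n)} {A B : Subset n} {z : Fin n} →
  PairwiseDisjoint π → A ∈ₗ π → B ∈ₗ π → z ∈ A → z ∈ B → A ≡ B
part-unique d (here refl) (here refl) _ _ = refl
part-unique d (here refl) (there B∈L) z∈A z∈B = ⊥-elim (disjoint-head d B∈L z∈A z∈B)
part-unique d (there A∈L) (here refl) z∈A z∈B = ⊥-elim (disjoint-head d A∈L z∈B z∈A)
part-unique d (there A∈L) (there B∈L) = part-unique (disjoint-tail d) A∈L B∈L

-- Since a partition has at least two non-empty disjoint parts, no part is all of X.
point-outside : {π : List (Subset n)} {A : Subset n} → IsPartition π → A ∈ₗ π → ∃[ y ] y ∉ A
point-outside {π = C ∷ []} (s≤s () , _) _
point-outside {π = C ∷ D ∷ _} (_ , nonempty , d , _) (here refl) =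
  let (y , y∈D) = nonempty D (there (here refl)) in y , λ y∈C → disjoint-head d (here refl) y∈C y∈D
point-outside {π = C ∷ D ∷ _} (_ , nonempty , d , _) (there A∈L) =
  let (y , y∈C) = nonempty C (here refl) in y , disjoint-head d A∈L y∈C

total : {X : Set} → (X → ℕ) → List X → ℕ
total f L = sum (map f L)

total-++ : {X : Set} (f : X → ℕ) (L M : List X) → total f (L ++ M) ≡ total f L + total f M
total-++ f L M = trans (cong sum (map-++ f L M)) (sum-++ (map f L) (map f M))

total-↭ : {X : Set} (f : X → ℕ) {L M : List X} → L ↭ M → total f L ≡ total f M
total-↭ f L↭M = sum-↭ (map⁺ f L↭M)

total-map : {X : Set} {f : X → ℕ} {g : X → X} → (∀ x → f (g x) ≡ f x) → (L : List X) → total f (map g L) ≡ total f L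
total-map {f = f} {g} fg≗f L = trans (cong sum (sym (map-∘ L))) (cong sum (map-cong fg≗f L))

+-2*-interchange : ∀ a b c d → (a + b) + 2 * (c + d) ≡ (a + 2 * c) + (b + 2 * d)
+-2*-interchange = solve-∀

total-linear : {X : Set} {f g h k : X → ℕ} → (∀ x → f x + 2 * g x ≡ h x + k x) →
  (L : List X) → total f L + 2 * total g L ≡ total h L + total k L
total-linear pointwise [] = refl
total-linear {f = f} {g} {h} {k} pointwise (x ∷ L) = begin
  (f x + total f L) + 2 * (g x + total g L)      ≡⟨ +-2*-interchange (f x) _ (g x) _ ⟩
  (f x + 2 * g x) + (total f L + 2 * total g L)  ≡⟨ cong₂ _+_ (pointwise x) (total-linear pointwise L) ⟩
  (h x + k x) + (total h L + total k L)          ≡⟨ +-interchange (h x) _ _ _ ⟩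
  (h x + total h L) + (k x + total k L)          ∎
  where
  open ≡-Reasoning
  +-interchange : ∀ a b c d → (a + b) + (c + d) ≡ (a + c) + (b + d)
  +-interchange = solve-∀

total-zero : {X : Set} {f : X → ℕ} {L : List X} → (∀ {x} → x ∈ₗ L → f x ≡ 0) → total f L ≡ 0
total-zero {L = []} _ = refl
total-zero {L = x ∷ L} zero-on-L = cong₂ _+_ (zero-on-L (here refl)) (total-zero (zero-on-L ∘ there))

total-positive : {X : Set} {f : X → ℕ} {L : List X} {x : X} → x ∈ₗ L → f x ≢ 0 → total f L ≢ 0
total-positive (here refl) fx≢0 = fx≢0 ∘ m+n≡0⇒m≡0 _
total-positive {f = f} {L = y ∷ _} (there x∈L) fx≢0 = total-positive x∈L fx≢0 ∘ m+n≡0⇒n≡0 (f y)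

total-witness : {X : Set} {f : X → ℕ} (L : List X) → total f L ≢ 0 → ∃[ x ] (x ∈ₗ L × f x ≢ 0)
total-witness [] total≢0 = ⊥-elim (total≢0 refl)
total-witness {f = f} (x ∷ L) total≢0 with f x ≟ 0
... | no fx≢0 = x , here refl , fx≢0
... | yes fx≡0 =
  let (y , y∈L , fy≢0) = total-witness L (total≢0 ∘ trans (cong (_+ total f L) fx≡0))
  in y , there y∈L , fy≢0

indicator : Bool → ℕ
indicator true = 1
indicator false = 0

member : Fin n → Subset n → ℕ
member a C = indicator (Vec.lookup C a)

separates : Fin n → Fin n → Subset n → ℕ
separates a b C = indicator (Vec.lookup C a xor Vec.lookup C b)

joins : Fin n → Fin n → Subset n → ℕ
joins a b C = indicator (Vec.lookup C a ∧ Vec.lookup C b)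

member-in : {a : Fin n} {C : Subset n} → a ∈ C → member a C ≡ 1
member-in a∈C = cong indicator ([]=⇒lookup a∈C)

member-out : {a : Fin n} {C : Subset n} → a ∉ C → member a C ≡ 0
member-out {a = a} {C} a∉C = cong indicator (¬-not (a∉C ∘ lookup⇒[]= a C))

weight-identity : (a b : Fin n) (C : Subset n) → separates a b C + 2 * joins a b C ≡ member a C + member b C
weight-identity a b C = bool-identity (Vec.lookup C a) (Vec.lookup C b)
  where
  bool-identity : ∀ p q → indicator (p xor q) + 2 * indicator (p ∧ q) ≡ indicator p + indicator q
  bool-identity true true = refl
  bool-identity true false = refl
  bool-identity false true = refl
  bool-identity false false = refl

separates-canon : (a b : Fin (suc m)) (C : Subset (suc m)) → separates a b (canon C) ≡ separates a b C
separates-canon a b C with canon-or-∁ C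
... | inj₁ e = cong (separates a b) e
... | inj₂ e = begin
  separates a b (canon C)                                   ≡⟨ cong (separates a b) e ⟩
  separates a b (∁ C)                                       ≡⟨ cong₂ (λ p q → indicator (p xor q)) (lookup-map a not C) (lookup-map b not C) ⟩
  indicator (not (Vec.lookup C a) xor not (Vec.lookup C b)) ≡⟨ cong indicator (xor-not-not (Vec.lookup C a) (Vec.lookup C b)) ⟩
  separates a b C                                           ∎
  where
  open ≡-Reasoning
  xor-not-not : ∀ p q → not p xor not q ≡ p xor q
  xor-not-not true true = refl
  xor-not-not true false = refl
  xor-not-not false true = refl
  xor-not-not false false = refl

both⇒joins≢0 : {a b : Fin n} {C : Subset n} → a ∈ C → b ∈ C → joins a b C ≢ 0
both⇒joins≢0 a∈C b∈C rewrite []=⇒lookup a∈C | []=⇒lookup b∈C = λ ()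

joins≢0⇒both : (a b : Fin n) (C : Subset n) → joins a b C ≢ 0 → a ∈ C × b ∈ C
joins≢0⇒both a b C joins≢0 = lookup⇒[]= a C (proj₁ both) , lookup⇒[]= b C (proj₂ both)
  where
  both-true : ∀ p q → indicator (p ∧ q) ≢ 0 → p ≡ true × q ≡ true
  both-true true true _ = refl , refl
  both-true true false ≢0 = ⊥-elim (≢0 refl)
  both-true false _ ≢0 = ⊥-elim (≢0 refl)
  both = both-true (Vec.lookup C a) (Vec.lookup C b) joins≢0

-- The counting identity

member-count : {π : List (Subset n)} {A : Subset n} {a : Fin n} →
  PairwiseDisjoint π → A ∈ₗ π → a ∈ A → total (member a) π ≡ 1
member-count d (here refl) a∈C = cong₂ _+_ (member-in a∈C) (total-zero (λ D∈L → member-out (disjoint-head d D∈L a∈C)))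
member-count d (there A∈L) a∈A =
  cong₂ _+_ (member-out (λ a∈C → disjoint-head d A∈L a∈C a∈A)) (member-count (disjoint-tail d) A∈L a∈A)

-- A partition contributes two splits separating a from b, or one part joining them.
partition-identity : {π : List (Subset (suc m))} → IsPartition π → (a b : Fin (suc m)) →
  total (separates a b) (splitsOf π) + 2 * total (joins a b) π ≡ 2
partition-identity {π = π} (_ , _ , d , cover) a b = begin
  total (separates a b) (map canon π) + 2 * total (joins a b) π  ≡⟨ cong (_+ 2 * total (joins a b) π) (total-map (separates-canon a b) π) ⟩
  total (separates a b) π + 2 * total (joins a b) π              ≡⟨ total-linear (weight-identity a b) π ⟩
  total (member a) π + total (member b) π                        ≡⟨ cong₂ _+_ (in-one-part a) (in-one-part b) ⟩
  2                                                              ∎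
  where
  open ≡-Reasoning
  in-one-part : ∀ c → total (member c) π ≡ 1
  in-one-part c = let (A , A∈π , c∈A) = cover c in member-count d A∈π c∈A

together : PartitionSystem m → Fin (suc m) → Fin (suc m) → ℕ
together Π a b = total (total (joins a b)) Π

system-identity : (Π : PartitionSystem m) → IsPartitionSystem Π → (a b : Fin (suc m)) →
  total (separates a b) (splitsOfSystem Π) + 2 * together Π a b ≡ 2 * length Π
system-identity [] _ a b = refl
system-identity (π ∷ Π) isPS a b = begin
  total (separates a b) (splitsOf π ++ splitsOfSystem Π) + 2 * (total (joins a b) π + together Π a b)
    ≡⟨ cong (_+ 2 * (total (joins a b) π + together Π a b)) (total-++ (separates a b) (splitsOf π) (splitsOfSystem Π)) ⟩
  (total (separates a b) (splitsOf π) + total (separates a b) (splitsOfSystem Π)) + 2 * (total (joins a b) π + together Π a b)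
    ≡⟨ +-2*-interchange (total (separates a b) (splitsOf π)) _ (total (joins a b) π) _ ⟩
  (total (separates a b) (splitsOf π) + 2 * total (joins a b) π) + (total (separates a b) (splitsOfSystem Π) + 2 * together Π a b)
    ≡⟨ cong₂ _+_ (partition-identity (isPS π (here refl)) a b) (system-identity Π (λ π → isPS π ∘ there) a b) ⟩
  2 + 2 * length Π
    ≡⟨ sym (*-suc 2 (length Π)) ⟩
  2 * length (π ∷ Π) ∎
  where open ≡-Reasoning

counting-identity : {S : SplitSystem m} {Π : PartitionSystem m} → InP S Π → (a b : Fin (suc m)) →
  total (separates a b) S + 2 * together Π a b ≡ 2 * length Π
counting-identity {Π = Π} (isPS , Σ-Π↭S) a b =
  trans (cong (_+ _) (sym (total-↭ (separates a b) Σ-Π↭S))) (system-identity Π isPS a b)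

equal-size⇒equal-together : {S : SplitSystem m} {Π Π′ : PartitionSystem m} → InP S Π → InP S Π′ →
  length Π ≡ length Π′ → ∀ a b → together Π a b ≡ together Π′ a b
equal-size⇒equal-together {S = S} {Π} {Π′} inΠ inΠ′ |Π|≡|Π′| a b =
  *-cancelˡ-≡ _ _ 2 (+-cancelˡ-≡ (total (separates a b) S) _ _ (begin
    total (separates a b) S + 2 * together Π a b   ≡⟨ counting-identity inΠ a b ⟩
    2 * length Π                                    ≡⟨ cong (2 *_) |Π|≡|Π′| ⟩
    2 * length Π′                                   ≡⟨ counting-identity inΠ′ a b ⟨
    total (separates a b) S + 2 * together Π′ a b  ∎))
  where open ≡-Reasoning

Joined : PartitionSystem m → Fin (suc m) → Fin (suc m) → Set
Joined Π a b = ∃[ π ] ∃[ A ] (π ∈ₗ Π × A ∈ₗ π × a ∈ A × b ∈ A)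

joined-sym : {Π : PartitionSystem m} {a b : Fin (suc m)} → Joined Π a b → Joined Π b a
joined-sym (π , A , π∈Π , A∈π , a∈A , b∈A) = π , A , π∈Π , A∈π , b∈A , a∈A

joined⇒together≢0 : {Π : PartitionSystem m} {a b : Fin (suc m)} → Joined Π a b → together Π a b ≢ 0
joined⇒together≢0 (_ , _ , π∈Π , A∈π , a∈A , b∈A) = total-positive π∈Π (total-positive A∈π (both⇒joins≢0 a∈A b∈A))

together≢0⇒joined : (Π : PartitionSystem m) (a b : Fin (suc m)) → together Π a b ≢ 0 → Joined Π a b
together≢0⇒joined Π a b T≢0 =
  let (π , π∈Π , count≢0) = total-witness Π T≢0
      (A , A∈π , joins≢0) = total-witness π count≢0
      (a∈A , b∈A) = joins≢0⇒both a b A joins≢0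
  in π , A , π∈Π , A∈π , a∈A , b∈A

unjoined⇒together≡0 : (Π : PartitionSystem m) (a b : Fin (suc m)) → ¬ Joined Π a b → together Π a b ≡ 0
unjoined⇒together≡0 Π a b ¬joined with together Π a b ≟ 0
... | yes T≡0 = T≡0
... | no T≢0 = ⊥-elim (¬joined (together≢0⇒joined Π a b T≢0))

joined-trans : {H : PartitionSystem m} {a b c : Fin (suc m)} → Hierarchical H → Joined H a b → Joined H b c → Joined H a c
joined-trans hier (π , A , π∈H , A∈π , a∈A , b∈A) (π′ , B , π′∈H , B∈π′ , b∈B , c∈B)
  with overlapping-nested (hier π π′ A B π∈H π′∈H A∈π B∈π′) b∈A b∈B
... | inj₁ A⊆B = π′ , B , π′∈H , B∈π′ , A⊆B a∈A , c∈B
... | inj₂ B⊆A = π , A , π∈H , A∈π , a∈A , B⊆A c∈B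

unjoined-∷ : {π : List (Subset (suc m))} {L : PartitionSystem m} {A₀ : Subset (suc m)} {p : Fin (suc m)} →
  IsPartition π → A₀ ∈ₗ π → zero ∈ A₀ → p ∉ A₀ → ¬ Joined L p zero → ¬ Joined (π ∷ L) p zero
unjoined-∷ (_ , _ , d , _) A₀∈π 0∈A₀ p∉A₀ _ (_ , A , here refl , A∈π , p∈A , 0∈A) =
  p∉A₀ (subst (_ ∈_) (part-unique d A∈π A₀∈π 0∈A 0∈A₀) p∈A)
unjoined-∷ _ _ _ _ ¬joined (π′ , A , there π′∈L , rest) = ¬joined (π′ , A , π′∈L , rest)

-- A hierarchical system has a point x sharing no part with the point 0:
-- the parts containing 0 form a chain, and x lies outside its largest member.
separated-point : (H : PartitionSystem m) → IsPartitionSystem H → Hierarchical H → ∃[ x ] ¬ Joined H x zero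
separated-point [] _ _ = zero , λ ()
separated-point (π ∷ L) isPS hier
  with separated-point L (λ π → isPS π ∘ there) (λ π π′ A B p p′ → hier π π′ A B (there p) (there p′))
     | proj₂ (proj₂ (proj₂ (isPS π (here refl)))) zero
... | x , x-sep | A₀ , A₀∈π , 0∈A₀ with x ∈? A₀
...   | no x∉A₀ = x , unjoined-∷ (isPS π (here refl)) A₀∈π 0∈A₀ x∉A₀ x-sep
...   | yes x∈A₀ = y , unjoined-∷ (isPS π (here refl)) A₀∈π 0∈A₀ y∉A₀ y-sep
  where
  -- If x shares the part A₀ with 0, any point y outside A₀ works: a part of L
  -- containing y and 0 would contain A₀ (nestedness), hence x.
  outside-A₀ = point-outside (isPS π (here refl)) A₀∈π
  y = proj₁ outside-A₀
  y∉A₀ = proj₂ outside-A₀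
  y-sep : ¬ Joined L y zero
  y-sep (π′ , A , π′∈L , A∈π′ , y∈A , 0∈A)
    with overlapping-nested (hier π′ π A A₀ (there π′∈L) (here refl) A∈π′ A₀∈π) 0∈A 0∈A₀
  ... | inj₁ A⊆A₀ = y∉A₀ (A⊆A₀ y∈A)
  ... | inj₂ A₀⊆A = x-sep (π′ , A , π′∈L , A∈π′ , A₀⊆A x∈A₀ , 0∈A)

canon-part∈S : {S : SplitSystem m} {Π : PartitionSystem m} {π : List (Subset (suc m))} {A : Subset (suc m)} →
  InP S Π → π ∈ₗ Π → A ∈ₗ π → canon A ∈ₗ S
canon-part∈S (_ , Σ-Π↭S) π∈Π A∈π =
  ∈-resp-↭ Σ-Π↭S (∈-concatMap⁺ splitsOf (Any.map (λ { refl → ∈-map⁺ canon A∈π }) π∈Π))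

hierarchical⇒minimum : {S : SplitSystem m} {Π : PartitionSystem m} → InP S Π → Hierarchical Π → IsMinimum S Π
hierarchical⇒minimum {S = S} {Π} inΠ hier Π′ inΠ′ = *-cancelˡ-≤ 2 (begin
  2 * length Π                                     ≡⟨ counting-identity inΠ x zero ⟨
  sep + 2 * together Π x zero                      ≡⟨ cong (λ t → sep + 2 * t) (unjoined⇒together≡0 Π x zero x-sep) ⟩
  sep + 0                                          ≡⟨ +-identityʳ sep ⟩
  sep                                              ≤⟨ m≤m+n sep _ ⟩
  sep + 2 * together Π′ x zero                     ≡⟨ counting-identity inΠ′ x zero ⟩
  2 * length Π′                                    ∎)
  where
  open ≤-Reasoning
  x = proj₁ (separated-point Π (proj₁ inΠ) hier)
  x-sep = proj₂ (separated-point Π (proj₁ inΠ) hier)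
  sep = total (separates x zero) S

-- If every pair joined in Π is joined in the hierarchical H and x is not joined
-- to 0 in H, then two parts of Π covering X are disjoint: a common point z would
-- join x to z and z to 0 in Π, hence x to 0 in H.
covering-parts-disjoint : {Π H : PartitionSystem m} {x : Fin (suc m)} {π π′ : List (Subset (suc m))} {A B : Subset (suc m)} →
  Hierarchical H → (∀ {a b} → Joined Π a b → Joined H a b) → ¬ Joined H x zero →
  π ∈ₗ Π → π′ ∈ₗ Π → A ∈ₗ π → B ∈ₗ π′ → Covers A B → Disjoint A B
covering-parts-disjoint {x = x} {π} {π′} {A} {B} hier transfer x-sep π∈Π π′∈Π A∈π B∈π′ cover {z} z∈A z∈B =
  x-sep (joined-trans hier (transfer (joined-to-z x)) (transfer (joined-sym (joined-to-z zero))))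
  where
  joined-to-z : ∀ p → Joined _ p z
  joined-to-z p with cover p
  ... | inj₁ p∈A = π , A , π∈Π , A∈π , p∈A , z∈A
  ... | inj₂ p∈B = π′ , B , π′∈Π , B∈π′ , p∈B , z∈B

-- (⇐) A minimum Π has the size of the hierarchical H, hence the same function T,
-- and its parts, pairwise compatible, are nested or disjoint.
minimum⇒hierarchical : {S : SplitSystem m} {H Π : PartitionSystem m} → Compatible S →
  InP S H → Hierarchical H → InP S Π → IsMinimum S Π → Hierarchical Π
minimum⇒hierarchical {H = H} {Π} compat inH hierH inΠ minimum π π′ A B π∈Π π′∈Π A∈π B∈π′ =
  nested (compatiblePair-canon (quadrant⇒compatiblePair
    (compat _ _ (canon-part∈S inΠ π∈Π A∈π) (canon-part∈S inΠ π′∈Π B∈π′))))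
  where
  same-size : length Π ≡ length H
  same-size = ≤-antisym (minimum H inH) (hierarchical⇒minimum inH hierH Π inΠ)
  transfer : ∀ {a b} → Joined Π a b → Joined H a b
  transfer {a} {b} joined = together≢0⇒joined H a b
    (joined⇒together≢0 joined ∘ trans (equal-size⇒equal-together inΠ inH same-size a b))
  x-sep = proj₂ (separated-point H (proj₁ inH) hierH)
  nested : CompatiblePair A B → Nested A B
  nested (disjoint d) = inj₁ (disjoint⇒∩≡⊥ d)
  nested (nested-left A⊆B) = inj₂ (inj₁ (⊆⇒∩≡ˡ A⊆B))
  nested (nested-right B⊆A) = inj₂ (inj₂ (⊇⇒∩≡ʳ B⊆A))
  nested (covering c) = inj₁ (disjoint⇒∩≡⊥ (covering-parts-disjoint hierH transfer x-sep π∈Π π′∈Π A∈π B∈π′ c))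

theorem7p4 : ∀ (m : _) → m ≥ 1 → (S : SplitSystem m) → IsSplitSystem S → Compatible S
    → (∃[ Π₀ ] (InP S Π₀ × Hierarchical Π₀))
    → (Π : PartitionSystem m) → InP S Π
    → (Hierarchical Π ⇔ IsMinimum S Π)
theorem7p4 m _ S _ compat (H , inH , hierH) Π inΠ =
  mk⇔ (hierarchical⇒minimum inΠ) (minimum⇒hierarchical compat inH hierH inΠ)
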